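{- Let $\ell\geq1$, $h\geq1$, $1\leq d\leq h$, and let $\mu=(h,1,\dotsc,1)$ be the hook with $\ell+1$ parts. Let $e_k(\mathbf{s})$ denote the $k$th elementary symmetric polynomial in $s_1,\dotsc,s_d$. Then \[ B_{\mu,d}(x,\mathbf{s})=x+\sum_{k=1}^{d}e_k(\mathbf{s})\,x^{\ell+1}(x+x^2+\cdots+x^\ell)^{k-1}, \] and $\sum_{n\geq0}S_{\mu,d,n}(\mathbf{s})x^n=\dfrac{1}{1-B_{\mu,d}(x,\mathbf{s})}$.
   Context: An anchor word for $\mu$ of length $n$ is a word $a_1\cdots a_n$ over $\{1,\dotsc,d,\infty\}$ such that $a_i\neq\infty$ implies $a_{i+k}\geq a_i+\mu_k$ for $k=1,\dotsc,\ell$ ($\infty$ larger than every integer) and $a_{n-\ell+1}=\cdots=a_n=\infty$. The weight of a word is $\mathrm{wt}(w)=\prod_{i:\,a_i\neq\infty}s_{a_i}$. $S_{\mu,d,n}(s_1,\dotsc,s_d)=\sum_w \mathrm{wt}(w)$ over anchor words of length $n$. A fault-free anchor word is either $(\infty)$ or a word starting with an integer, ending with $\ell$ consecutive $\infty$'s, with that final block the only occurrence of $\ell$ consecutive $\infty$'s; $B_{\mu,d}(x,\mathbf{s})=\sum x^{\mathrm{length}(w)}\mathrm{wt}(w)$ over fault-free anchor words $w$. -}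

module Defs where

open import Level using (Level)
open import Data.Nat using (ℕ; zero; suc; _∸_; _≤ᵇ_) renaming (_+_ to _+ℕ_)
open import Data.Bool using (Bool; true; false; _∧_; _∨_; not; if_then_else_)
open import Data.Maybe using (Maybe; just; nothing; is-nothing; is-just)
open import Data.Fin using (Fin; toℕ)
open import Data.List using (List; []; _∷_; map; concatMap; take; drop; length; allFin; tabulate; filterᵇ; foldr)
open import Algebra.Bundles using (CommutativeRing)

-- Words over {1,…,d,∞}.  `just j` encodes the integer (toℕ j + 1),
-- `nothing` encodes ∞.  Since all comparisons are of the form
-- b ≥ a + μ_k, the shift by 1 is irrelevant.

Letter : ℕ → Set
Letter d = Maybe (Fin d)

allInf : ∀ {d} → List (Letter d) → Bool
allInf []      = true
allInf (a ∷ w) = is-nothing a ∧ allInf w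

allWords : (d n : ℕ) → List (List (Letter d))
allWords d zero    = [] ∷ []
allWords d (suc n) =
  concatMap (λ a → map (a ∷_) (allWords d n)) (nothing ∷ map just (allFin d))

-- μ is given by its parts μ k (k = 0,…,ℓ); only μ_1,…,μ_ℓ enter.
-- okAfter μ a k w : every letter of w at offset k, k+1, … (from the
-- letter a) is ∞ or ≥ a + μ_offset.
okAfter : ∀ {d} → (ℕ → ℕ) → Fin d → ℕ → List (Letter d) → Bool
okAfter μ a k []             = true
okAfter μ a k (nothing ∷ w)  = okAfter μ a (suc k) w
okAfter μ a k (just b ∷ w)   = (toℕ a +ℕ μ k ≤ᵇ toℕ b) ∧ okAfter μ a (suc k) w

-- a_i ≠ ∞ ⇒ a_{i+k} ≥ a_i + μ_k for k = 1,…,ℓ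
incCond : ∀ {d} → (ℕ → ℕ) → ℕ → List (Letter d) → Bool
incCond μ ℓ []            = true
incCond μ ℓ (nothing ∷ w) = incCond μ ℓ w
incCond μ ℓ (just a ∷ w)  = okAfter μ a 1 (take ℓ w) ∧ incCond μ ℓ w

endsInf : ∀ {d} → ℕ → List (Letter d) → Bool
endsInf ℓ w = allInf (drop (length w ∸ ℓ) w)

isAnchor : ∀ {d} → (ℕ → ℕ) → ℕ → List (Letter d) → Bool
isAnchor μ ℓ w = incCond μ ℓ w ∧ endsInf ℓ w

noEarlyBlock : ∀ {d} → ℕ → List (Letter d) → Bool
noEarlyBlock ℓ []       = true
noEarlyBlock ℓ (a ∷ w)  =
  if length (a ∷ w) ≤ᵇ ℓ then true
  else (not (allInf (take ℓ (a ∷ w))) ∧ noEarlyBlock ℓ w)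

isSingleInf : ∀ {d} → List (Letter d) → Bool
isSingleInf (nothing ∷ []) = true
isSingleInf _              = false

startsInt : ∀ {d} → List (Letter d) → Bool
startsInt []      = false
startsInt (a ∷ w) = is-just a

isFaultFree : ∀ {d} → (ℕ → ℕ) → ℕ → List (Letter d) → Bool
isFaultFree μ ℓ w =
  isSingleInf w ∨ (startsInt w ∧ isAnchor μ ℓ w ∧ noEarlyBlock ℓ w)

hook : ℕ → ℕ → ℕ
hook h zero    = h
hook h (suc k) = 1

-- Everything with coefficients in an arbitrary commutative ring R,
-- with s_1,…,s_d ∈ R (polynomial identities in ℤ[s] ⇔ identities for
-- all such evaluations).

module Series {c ℓr : Level} (R : CommutativeRing c ℓr) where
  open CommutativeRing R using (Carrier; _≈_; _+_; _*_; _-_; 0#; 1#)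

  sumR : List Carrier → Carrier
  sumR = foldr _+_ 0#

  prodR : List Carrier → Carrier
  prodR = foldr _*_ 1#

  wt : ∀ {d} → (Fin d → Carrier) → List (Letter d) → Carrier
  wt s []            = 1#
  wt s (nothing ∷ w) = wt s w
  wt s (just a ∷ w)  = s a * wt s w

  PS : Set c
  PS = ℕ → Carrier

  _≋_ : PS → PS → Set ℓr
  f ≋ g = ∀ n → f n ≈ g n

  sumTo : (ℕ → Carrier) → ℕ → Carrier
  sumTo f zero    = f zero
  sumTo f (suc n) = sumTo f n + f (suc n)

  _⊕_ : PS → PS → PS
  (f ⊕ g) n = f n + g n

  _⊖_ : PS → PS → PS
  (f ⊖ g) n = f n - g n

  _⊛_ : PS → PS → PS
  (f ⊛ g) n = sumTo (λ i → f i * g (n ∸ i)) n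

  const : Carrier → PS
  const a zero    = a
  const a (suc n) = 0#

  zeroPS onePS X : PS
  zeroPS _ = 0#
  onePS = const 1#
  X zero          = 0#
  X (suc zero)    = 1#
  X (suc (suc n)) = 0#

  _^PS_ : PS → ℕ → PS
  f ^PS zero  = onePS
  f ^PS suc k = f ⊛ (f ^PS k)

  Σ₁ : (ℕ → PS) → ℕ → PS
  Σ₁ F zero    = zeroPS
  Σ₁ F (suc n) = Σ₁ F n ⊕ F (suc n)

  S : (ℕ → ℕ) → (ℓ d : ℕ) → (Fin d → Carrier) → ℕ → Carrier
  S μ ℓ d s n = sumR (map (wt s) (filterᵇ (isAnchor μ ℓ) (allWords d n)))

  B : (ℕ → ℕ) → (ℓ d : ℕ) → (Fin d → Carrier) → PS
  B μ ℓ d s n = sumR (map (wt s) (filterᵇ (isFaultFree μ ℓ) (allWords d n)))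

  elem : ℕ → List Carrier → Carrier
  elem zero    _        = 1#
  elem (suc k) []       = 0#
  elem (suc k) (x ∷ xs) = elem (suc k) xs + x * elem k xs

  e : ∀ {d} → ℕ → (Fin d → Carrier) → Carrier
  e k s = elem k (tabulate s)

{-# OPTIONS --safe #-}

-- For the hook only μ₁ = ⋯ = μ_ℓ = 1 matter: every integer among the ℓ letters following an integer
-- letter a must exceed a.  If the next integer letter b lies in the window of a, then a < b and the
-- window of b covers what is left of that of a, so it suffices to remember the last integer letter
-- and how many more positions its window covers.  Anchor words and fault-free words are thus
-- recognised by automata on these states, and reading the first letter gives recursions for their
-- weighted generating series.  The two recursions agree until the window closes with ℓ ∞'s; there
-- an anchor word starts afresh while a fault-free word must end.  Hence an anchor word is uniquely
-- a fault-free word followed by an anchor word, S = 1 + B S, i.e. S (1 - B) = 1.  A fault-free word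
-- other than (∞) is an increasing sequence of integers i₁ < ⋯ < i_k separated by fewer than ℓ ∞'s
-- and followed by exactly ℓ ∞'s; for fixed i₁ < ⋯ < i_k these words contribute s_{i₁} ⋯ s_{i_k} x
-- (x + ⋯ + x^ℓ)^{k-1} x^ℓ, and summing over the increasing sequences yields the elementary
-- symmetric polynomials e_k(s).

module Submission where

open import Defs
open import Level using (Level)
open import Function using (_∘_; Equivalence)
open import Data.Bool using (Bool; true; false; _∧_; _∨_; not; T)
open import Data.Bool.Properties
  using (∧-assoc; ∧-comm; ∧-identityʳ; ∧-zeroʳ; ∨-zeroʳ; ¬-not; T-∧; T-≡)
open import Data.Empty using (⊥-elim)
open import Data.Fin as Fin using (Fin; toℕ)
open import Data.List
  using (List; []; _∷_; map; _++_; take; drop; length; replicate; allFin; tabulate; filterᵇ; concatMap)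
open import Data.List.Properties using (map-++; map-∘; map-tabulate; length-++; length-replicate)
open import Data.Maybe using (just; nothing)
open import Data.Nat using (ℕ; zero; suc; pred; _∸_; _≤_; _<_; _≤ᵇ_; _<ᵇ_; z≤n; s≤s; _≤?_; _<?_)
import Data.Nat.Properties as ℕₚ
open import Data.Product using (_×_; _,_)
open import Data.Unit using (tt)
open import Relation.Binary.Bundles using (Setoid)
open import Relation.Nullary using (yes; no)
open import Relation.Binary.PropositionalEquality as ≡ using (_≡_; cong; cong₂)
open import Algebra.Bundles using (CommutativeRing; CommutativeSemigroup)
import Relation.Binary.Reasoning.Setoid as SetoidReasoning

module RingSums {c ℓr : Level} (R : CommutativeRing c ℓr) where
  open CommutativeRing R hiding (zero)
  open Series R using (sumR; sumTo)
  open import Algebra.Properties.Ring ring using (-‿+-comm)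
  open import Algebra.Properties.CommutativeSemigroup +-commutativeSemigroup using (interchange)

  when : Bool → Carrier → Carrier
  when true  x = x
  when false x = 0#

  when-*ˡ : ∀ b x y → when b (x * y) ≈ x * when b y
  when-*ˡ true  x y = refl
  when-*ˡ false x y = sym (zeroʳ x)

  sumR-++ : ∀ xs ys → sumR (xs ++ ys) ≈ sumR xs + sumR ys
  sumR-++ []       ys = sym (+-identityˡ _)
  sumR-++ (x ∷ xs) ys = trans (+-congˡ (sumR-++ xs ys)) (sym (+-assoc _ _ _))

  module _ {a} {A : Set a} where

    sumR-cong : ∀ (xs : List A) {f g : A → Carrier} → (∀ x → f x ≈ g x) →
                sumR (map f xs) ≈ sumR (map g xs)
    sumR-cong []       f≈g = refl
    sumR-cong (x ∷ xs) f≈g = +-cong (f≈g x) (sumR-cong xs f≈g)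

    sumR-zero : ∀ (xs : List A) {f : A → Carrier} → (∀ x → f x ≈ 0#) → sumR (map f xs) ≈ 0#
    sumR-zero []       f≈0 = refl
    sumR-zero (x ∷ xs) f≈0 = trans (+-cong (f≈0 x) (sumR-zero xs f≈0)) (+-identityˡ 0#)

    sumR-*ˡ : ∀ (xs : List A) a (f : A → Carrier) → sumR (map (λ x → a * f x) xs) ≈ a * sumR (map f xs)
    sumR-*ˡ []       a f = sym (zeroʳ a)
    sumR-*ˡ (x ∷ xs) a f = trans (+-congˡ (sumR-*ˡ xs a f)) (sym (distribˡ a _ _))

  sumR-concatMap : ∀ {a b} {A : Set a} {B : Set b} (f : B → Carrier) (g : A → List B) (xs : List A) →
                   sumR (map f (concatMap g xs)) ≈ sumR (map (λ x → sumR (map f (g x))) xs)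
  sumR-concatMap f g []       = refl
  sumR-concatMap f g (x ∷ xs) = begin
      sumR (map f (g x ++ concatMap g xs))
    ≡⟨ cong sumR (map-++ f (g x) _) ⟩
      sumR (map f (g x) ++ map f (concatMap g xs))
    ≈⟨ sumR-++ (map f (g x)) _ ⟩
      sumR (map f (g x)) + sumR (map f (concatMap g xs))
    ≈⟨ +-congˡ (sumR-concatMap f g xs) ⟩
      sumR (map (λ x → sumR (map f (g x))) (x ∷ xs)) ∎
    where open SetoidReasoning setoid

  sumTab-cong : ∀ {d} {f g : Fin d → Carrier} → (∀ i → f i ≈ g i) →
                sumR (tabulate f) ≈ sumR (tabulate g)
  sumTab-cong {zero}  f≈g = refl
  sumTab-cong {suc d} f≈g = +-cong (f≈g Fin.zero) (sumTab-cong (f≈g ∘ Fin.suc))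

  sumTab-zero : ∀ {d} {f : Fin d → Carrier} → (∀ i → f i ≈ 0#) → sumR (tabulate f) ≈ 0#
  sumTab-zero {zero}  f≈0 = refl
  sumTab-zero {suc d} f≈0 = trans (+-cong (f≈0 Fin.zero) (sumTab-zero (f≈0 ∘ Fin.suc))) (+-identityˡ 0#)

  sumTo-cong : ∀ {f g} n → (∀ i → i ≤ n → f i ≈ g i) → sumTo f n ≈ sumTo g n
  sumTo-cong zero    f≈g = f≈g zero z≤n
  sumTo-cong (suc n) f≈g =
    +-cong (sumTo-cong n (λ i i≤n → f≈g i (ℕₚ.m≤n⇒m≤1+n i≤n))) (f≈g (suc n) ℕₚ.≤-refl)

  sumTo-+ : ∀ f g n → sumTo (λ i → f i + g i) n ≈ sumTo f n + sumTo g n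
  sumTo-+ f g zero    = refl
  sumTo-+ f g (suc n) = trans (+-congʳ (sumTo-+ f g n)) (interchange _ _ _ _)

  sumTo-*ˡ : ∀ a f n → sumTo (λ i → a * f i) n ≈ a * sumTo f n
  sumTo-*ˡ a f zero    = refl
  sumTo-*ˡ a f (suc n) = trans (+-congʳ (sumTo-*ˡ a f n)) (sym (distribˡ a _ _))

  sumTo-neg : ∀ f n → sumTo (λ i → - f i) n ≈ - sumTo f n
  sumTo-neg f zero    = refl
  sumTo-neg f (suc n) = trans (+-congʳ (sumTo-neg f n)) (-‿+-comm _ _)

  sumTo-zero : ∀ {f} n → (∀ i → f i ≈ 0#) → sumTo f n ≈ 0#
  sumTo-zero zero    f≈0 = f≈0 zero
  sumTo-zero (suc n) f≈0 = trans (+-cong (sumTo-zero n f≈0) (f≈0 (suc n))) (+-identityˡ 0#)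

  sumTo-suc : ∀ f n → sumTo f (suc n) ≈ f zero + sumTo (f ∘ suc) n
  sumTo-suc f zero    = refl
  sumTo-suc f (suc n) = trans (+-congʳ (sumTo-suc f n)) (+-assoc _ _ _)

  sumTo-reverse : ∀ f n → sumTo f n ≈ sumTo (λ i → f (n ∸ i)) n
  sumTo-reverse f zero    = refl
  sumTo-reverse f (suc n) = begin
      sumTo f n + f (suc n)
    ≈⟨ +-congʳ (sumTo-reverse f n) ⟩
      sumTo (λ i → f (n ∸ i)) n + f (suc n)
    ≈⟨ +-comm _ _ ⟩
      f (suc n) + sumTo (λ i → f (n ∸ i)) n
    ≈⟨ sym (sumTo-suc (λ i → f (suc n ∸ i)) n) ⟩
      sumTo (λ i → f (suc n ∸ i)) (suc n) ∎
    where open SetoidReasoning setoid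

module PowerSeries {c ℓr : Level} (R : CommutativeRing c ℓr) where
  open CommutativeRing R hiding (zero)
  open Series R
  open RingSums R
  open import Algebra.Properties.Ring ring using (-‿distribʳ-*)
  open import Algebra.Solver.Ring.NaturalCoefficients.Default commutativeSemiring using (solve; _:+_; _:*_; _:=_)

  ≋-setoid : Setoid c ℓr
  ≋-setoid = record
    { Carrier       = PS
    ; _≈_           = _≋_
    ; isEquivalence = record
      { refl  = λ _ → refl
      ; sym   = λ f≋g n → sym (f≋g n)
      ; trans = λ f≋g g≋h n → trans (f≋g n) (g≋h n)
      }
    }

  open Setoid ≋-setoid public using ()
    renaming (refl to ≋-refl; sym to ≋-sym; trans to ≋-trans; isEquivalence to ≋-isEquivalence)
  module ≋-Reasoning = SetoidReasoning ≋-setoid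

  infixl 7 _·_
  _·_ : Carrier → PS → PS
  (a · f) n = a * f n

  ΣFin : ∀ {d} → (Fin d → PS) → PS
  ΣFin F n = sumR (tabulate (λ i → F i n))

  ⊕-cong : ∀ {f f′ g g′} → f ≋ f′ → g ≋ g′ → (f ⊕ g) ≋ (f′ ⊕ g′)
  ⊕-cong f≋f′ g≋g′ n = +-cong (f≋f′ n) (g≋g′ n)

  ⊕-congˡ : ∀ {f g g′} → g ≋ g′ → (f ⊕ g) ≋ (f ⊕ g′)
  ⊕-congˡ g≋g′ n = +-congˡ (g≋g′ n)

  ⊕-congʳ : ∀ {f f′ g} → f ≋ f′ → (f ⊕ g) ≋ (f′ ⊕ g)
  ⊕-congʳ f≋f′ n = +-congʳ (f≋f′ n)

  ⊖-congˡ : ∀ f {g g′} → g ≋ g′ → (f ⊖ g) ≋ (f ⊖ g′)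
  ⊖-congˡ f g≋g′ n = +-congˡ (-‿cong (g≋g′ n))

  ·-congˡ : ∀ {a f g} → f ≋ g → (a · f) ≋ (a · g)
  ·-congˡ f≋g n = *-congˡ (f≋g n)

  ⊛-cong : ∀ {f f′ g g′} → f ≋ f′ → g ≋ g′ → (f ⊛ g) ≋ (f′ ⊛ g′)
  ⊛-cong f≋f′ g≋g′ n = sumTo-cong n (λ i _ → *-cong (f≋f′ i) (g≋g′ (n ∸ i)))

  ⊛-congˡ : ∀ f {g g′} → g ≋ g′ → (f ⊛ g) ≋ (f ⊛ g′)
  ⊛-congˡ f g≋g′ n = sumTo-cong n (λ i _ → *-congˡ (g≋g′ (n ∸ i)))

  ⊛-congʳ : ∀ {f f′} g → f ≋ f′ → (f ⊛ g) ≋ (f′ ⊛ g)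
  ⊛-congʳ g f≋f′ n = sumTo-cong n (λ i _ → *-congʳ (f≋f′ i))

  ΣFin-cong : ∀ {d} {F G : Fin d → PS} → (∀ i → F i ≋ G i) → ΣFin F ≋ ΣFin G
  ΣFin-cong F≋G n = sumTab-cong (λ i → F≋G i n)

  const-cong : ∀ {a b} → a ≈ b → const a ≋ const b
  const-cong a≈b zero    = a≈b
  const-cong a≈b (suc n) = refl

  const-0# : const 0# ≋ zeroPS
  const-0# zero    = refl
  const-0# (suc n) = refl

  ⊕-assoc : ∀ f g h → ((f ⊕ g) ⊕ h) ≋ (f ⊕ (g ⊕ h))
  ⊕-assoc f g h n = +-assoc _ _ _

  ⊕-comm : ∀ f g → (f ⊕ g) ≋ (g ⊕ f)
  ⊕-comm f g n = +-comm _ _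

  ⊕-identityˡ : ∀ f → (zeroPS ⊕ f) ≋ f
  ⊕-identityˡ f n = +-identityˡ _

  ⊕-identityʳ : ∀ f → (f ⊕ zeroPS) ≋ f
  ⊕-identityʳ f n = +-identityʳ _

  ⊛-comm : ∀ f g → (f ⊛ g) ≋ (g ⊛ f)
  ⊛-comm f g n = trans (sumTo-reverse (λ i → f i * g (n ∸ i)) n)
    (sumTo-cong n (λ i i≤n → trans (*-comm _ _) (*-congʳ (reflexive (cong g (ℕₚ.m∸[m∸n]≡n i≤n))))))

  ⊛-suc : ∀ f g → (λ n → (f ⊛ g) (suc n)) ≋ ((f zero · (g ∘ suc)) ⊕ ((f ∘ suc) ⊛ g))
  ⊛-suc f g n = sumTo-suc _ n

  ⊛-zeroˡ : ∀ f → (zeroPS ⊛ f) ≋ zeroPS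
  ⊛-zeroˡ f n = sumTo-zero n (λ i → zeroˡ _)

  ⊛-distribʳ : ∀ f g h → ((f ⊕ g) ⊛ h) ≋ ((f ⊛ h) ⊕ (g ⊛ h))
  ⊛-distribʳ f g h n = trans (sumTo-cong n (λ i _ → distribʳ _ _ _)) (sumTo-+ _ _ n)

  ⊛-distribˡ : ∀ f g h → (f ⊛ (g ⊕ h)) ≋ ((f ⊛ g) ⊕ (f ⊛ h))
  ⊛-distribˡ f g h = begin
    f ⊛ (g ⊕ h)            ≈⟨ ⊛-comm f _ ⟩
    (g ⊕ h) ⊛ f            ≈⟨ ⊛-distribʳ g h f ⟩
    (g ⊛ f) ⊕ (h ⊛ f)      ≈⟨ ⊕-cong (⊛-comm g f) (⊛-comm h f) ⟩
    (f ⊛ g) ⊕ (f ⊛ h)      ∎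
    where open ≋-Reasoning

  ·-⊛ : ∀ a f g → ((a · f) ⊛ g) ≋ (a · (f ⊛ g))
  ·-⊛ a f g n = trans (sumTo-cong n (λ i _ → *-assoc _ _ _)) (sumTo-*ˡ a _ n)

  ⊛-⊖ : ∀ f g h → (f ⊛ (g ⊖ h)) ≋ ((f ⊛ g) ⊖ (f ⊛ h))
  ⊛-⊖ f g h n = begin
      sumTo (λ i → f i * (g (n ∸ i) - h (n ∸ i))) n
    ≈⟨ sumTo-cong n (λ i _ → trans (distribˡ _ _ _) (+-congˡ (sym (-‿distribʳ-* _ _)))) ⟩
      sumTo (λ i → f i * g (n ∸ i) + - (f i * h (n ∸ i))) n
    ≈⟨ sumTo-+ _ _ n ⟩
      (f ⊛ g) n + sumTo (λ i → - (f i * h (n ∸ i))) n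
    ≈⟨ +-congˡ (sumTo-neg _ n) ⟩
      (f ⊛ g) n - (f ⊛ h) n ∎
    where open SetoidReasoning setoid

  -- Induction on the index, peeling off the constant term of f with ⊛-suc; no double sum is reindexed.
  ⊛-assoc : ∀ f g h → ((f ⊛ g) ⊛ h) ≋ (f ⊛ (g ⊛ h))
  ⊛-assoc f g h zero    = *-assoc _ _ _
  ⊛-assoc f g h (suc n) = begin
      ((f ⊛ g) ⊛ h) (suc n)
    ≈⟨ ⊛-suc (f ⊛ g) h n ⟩
      f₀ * g₀ * h (suc n) + (((f ⊛ g) ∘ suc) ⊛ h) n
    ≈⟨ +-congˡ (⊛-congʳ h (⊛-suc f g) n) ⟩
      f₀ * g₀ * h (suc n) + (((f₀ · (g ∘ suc)) ⊕ ((f ∘ suc) ⊛ g)) ⊛ h) n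
    ≈⟨ +-congˡ (⊛-distribʳ _ _ h n) ⟩
      f₀ * g₀ * h (suc n) + (((f₀ · (g ∘ suc)) ⊛ h) n + (((f ∘ suc) ⊛ g) ⊛ h) n)
    ≈⟨ +-congˡ (+-cong (·-⊛ f₀ (g ∘ suc) h n) (⊛-assoc (f ∘ suc) g h n)) ⟩
      f₀ * g₀ * h (suc n) + (f₀ * ((g ∘ suc) ⊛ h) n + ((f ∘ suc) ⊛ (g ⊛ h)) n)
    ≈⟨ regroup f₀ g₀ (h (suc n)) _ _ ⟩
      f₀ * (g₀ * h (suc n) + ((g ∘ suc) ⊛ h) n) + ((f ∘ suc) ⊛ (g ⊛ h)) n
    ≈⟨ sym (+-congʳ (*-congˡ (⊛-suc g h n))) ⟩
      f₀ * (g ⊛ h) (suc n) + ((f ∘ suc) ⊛ (g ⊛ h)) n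
    ≈⟨ sym (⊛-suc f (g ⊛ h) n) ⟩
      (f ⊛ (g ⊛ h)) (suc n) ∎
    where
      open SetoidReasoning setoid
      f₀ = f zero
      g₀ = g zero
      regroup : ∀ a b x y z → a * b * x + (a * y + z) ≈ a * (b * x + y) + z
      regroup = solve 5 (λ a b x y z → a :* b :* x :+ (a :* y :+ z) := a :* (b :* x :+ y) :+ z) refl

  ⊛-commutativeSemigroup : CommutativeSemigroup c ℓr
  ⊛-commutativeSemigroup = record
    { Carrier                 = PS
    ; _≈_                     = _≋_
    ; _∙_                     = _⊛_
    ; isCommutativeSemigroup  = record
      { isSemigroup = record
        { isMagma = record { isEquivalence = ≋-isEquivalence ; ∙-cong = ⊛-cong }
        ; assoc   = ⊛-assoc
        }
      ; comm = ⊛-comm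
      }
    }

  open import Algebra.Properties.CommutativeSemigroup ⊛-commutativeSemigroup public
    using () renaming (x∙yz≈y∙xz to ⊛-leftComm)

  const-⊛ : ∀ a f → (const a ⊛ f) ≋ (a · f)
  const-⊛ a f zero    = refl
  const-⊛ a f (suc n) = begin
      (const a ⊛ f) (suc n)
    ≈⟨ ⊛-suc (const a) f n ⟩
      a * f (suc n) + (zeroPS ⊛ f) n
    ≈⟨ +-congˡ (⊛-zeroˡ f n) ⟩
      a * f (suc n) + 0#
    ≈⟨ +-identityʳ _ ⟩
      a * f (suc n) ∎
    where open SetoidReasoning setoid

  ⊛-identityˡ : ∀ f → (onePS ⊛ f) ≋ f
  ⊛-identityˡ f n = trans (const-⊛ 1# f n) (*-identityˡ (f n))

  ⊛-identityʳ : ∀ f → (f ⊛ onePS) ≋ f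
  ⊛-identityʳ f = ≋-trans (⊛-comm f onePS) (⊛-identityˡ f)

  X⊛-zero : ∀ f → (X ⊛ f) zero ≈ 0#
  X⊛-zero f = zeroˡ (f zero)

  X⊛-suc : ∀ f n → (X ⊛ f) (suc n) ≈ f n
  X⊛-suc f n = begin
      (X ⊛ f) (suc n)
    ≈⟨ ⊛-suc X f n ⟩
      0# * f (suc n) + ((X ∘ suc) ⊛ f) n
    ≈⟨ +-cong (zeroˡ _) (⊛-congʳ f X∘suc≋1 n) ⟩
      0# + (onePS ⊛ f) n
    ≈⟨ trans (+-identityˡ _) (⊛-identityˡ f n) ⟩
      f n ∎
    where
      open SetoidReasoning setoid
      X∘suc≋1 : (X ∘ suc) ≋ onePS
      X∘suc≋1 zero    = refl
      X∘suc≋1 (suc n) = refl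

  X⊛-unfold : ∀ f → f ≋ (const (f zero) ⊕ (X ⊛ (f ∘ suc)))
  X⊛-unfold f zero    = sym (trans (+-congˡ (X⊛-zero (f ∘ suc))) (+-identityʳ _))
  X⊛-unfold f (suc n) = sym (trans (+-identityˡ _) (X⊛-suc (f ∘ suc) n))

  ⊛-Σ₁ : ∀ f F n → (f ⊛ Σ₁ F n) ≋ Σ₁ (λ k → f ⊛ F k) n
  ⊛-Σ₁ f F zero    = ≋-trans (⊛-comm f zeroPS) (⊛-zeroˡ f)
  ⊛-Σ₁ f F (suc n) = ≋-trans (⊛-distribˡ f (Σ₁ F n) (F (suc n))) (⊕-congʳ (⊛-Σ₁ f F n))

  Σ₁-cong : ∀ {F G} n → (∀ k → F (suc k) ≋ G (suc k)) → Σ₁ F n ≋ Σ₁ G n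
  Σ₁-cong zero    F≋G = ≋-refl
  Σ₁-cong (suc n) F≋G = ⊕-cong (Σ₁-cong n F≋G) (F≋G n)

  Σ₁-⊕ : ∀ F G n → Σ₁ (λ k → F k ⊕ G k) n ≋ (Σ₁ F n ⊕ Σ₁ G n)
  Σ₁-⊕ F G zero    m = sym (+-identityˡ _)
  Σ₁-⊕ F G (suc n) m = trans (+-congʳ (Σ₁-⊕ F G n m)) (interchange _ _ _ _)
    where open import Algebra.Properties.CommutativeSemigroup +-commutativeSemigroup using (interchange)

  Σ₁-· : ∀ a F n → Σ₁ (λ k → a · F k) n ≋ (a · Σ₁ F n)
  Σ₁-· a F zero    m = sym (zeroʳ a)
  Σ₁-· a F (suc n) m = trans (+-congʳ (Σ₁-· a F n m)) (sym (distribˡ a _ _))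

  Σ₁-suc : ∀ F n → Σ₁ F (suc n) ≋ (F 1 ⊕ Σ₁ (F ∘ suc) n)
  Σ₁-suc F zero    m = +-comm _ _
  Σ₁-suc F (suc n) m = trans (+-congʳ (Σ₁-suc F n m)) (+-assoc _ _ _)

  Σ₁-powers-suc : ∀ f r → Σ₁ (f ^PS_) (suc r) ≋ (f ⊛ (onePS ⊕ Σ₁ (f ^PS_) r))
  Σ₁-powers-suc f zero = begin
    zeroPS ⊕ (f ⊛ onePS)           ≈⟨ ⊕-identityˡ _ ⟩
    f ⊛ onePS                      ≈⟨ ⊛-congˡ f (≋-sym (⊕-identityʳ onePS)) ⟩
    f ⊛ (onePS ⊕ zeroPS)           ∎
    where open ≋-Reasoning
  Σ₁-powers-suc f (suc r) = begin
    Σ₁ (f ^PS_) (suc r) ⊕ (f ⊛ fʳ⁺¹)       ≈⟨ ⊕-congʳ (Σ₁-powers-suc f r) ⟩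
    (f ⊛ (onePS ⊕ Yᵣ)) ⊕ (f ⊛ fʳ⁺¹)        ≈⟨ ≋-sym (⊛-distribˡ f (onePS ⊕ Yᵣ) fʳ⁺¹) ⟩
    f ⊛ ((onePS ⊕ Yᵣ) ⊕ fʳ⁺¹)              ≈⟨ ⊛-congˡ f (⊕-assoc onePS Yᵣ fʳ⁺¹) ⟩
    f ⊛ (onePS ⊕ Σ₁ (f ^PS_) (suc r))      ∎
    where
      open ≋-Reasoning
      Yᵣ   = Σ₁ (f ^PS_) r
      fʳ⁺¹ = f ^PS suc r

  ΣFin-⊛ : ∀ {d} (F : Fin d → PS) g → (ΣFin F ⊛ g) ≋ ΣFin (λ i → F i ⊛ g)
  ΣFin-⊛ {zero}  F g = ⊛-zeroˡ g
  ΣFin-⊛ {suc d} F g =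
    ≋-trans (⊛-distribʳ (F Fin.zero) (ΣFin (F ∘ Fin.suc)) g) (⊕-congˡ (ΣFin-⊛ (F ∘ Fin.suc) g))

  ⊛-inverse : ∀ {A B} → A ≋ (onePS ⊕ (B ⊛ A)) → (A ⊛ (onePS ⊖ B)) ≋ onePS
  ⊛-inverse {A} {B} A≋1+BA = begin
    A ⊛ (onePS ⊖ B)               ≈⟨ ⊛-⊖ A onePS B ⟩
    (A ⊛ onePS) ⊖ (A ⊛ B)         ≈⟨ (λ n → +-cong (⊛-identityʳ A n) (-‿cong (⊛-comm A B n))) ⟩
    A ⊖ (B ⊛ A)                   ≈⟨ (λ n → +-congʳ (A≋1+BA n)) ⟩
    (onePS ⊕ (B ⊛ A)) ⊖ (B ⊛ A)   ≈⟨ (λ n → trans (+-assoc _ _ _) (trans (+-congˡ (-‿inverseʳ _)) (+-identityʳ _))) ⟩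
    onePS                         ∎
    where open ≋-Reasoning

  0·⊕ : ∀ f g → ((0# · f) ⊕ g) ≋ g
  0·⊕ f g n = trans (+-congʳ (zeroˡ (f n))) (+-identityˡ (g n))

  eSeries : PS → PS → ∀ {d} → (Fin d → Carrier) → PS
  eSeries P Q {d} s = Σ₁ (λ k → const (e k s) ⊛ (P ⊛ (Q ^PS (k ∸ 1)))) d

  e-vanish : ∀ {d} k (s : Fin d → Carrier) → d ≤ k → e (suc k) s ≈ 0#
  e-vanish {zero}  k       s _         = refl
  e-vanish {suc d} (suc k) s (s≤s d≤k) = begin
      e (suc (suc k)) (s ∘ Fin.suc) + s Fin.zero * e (suc k) (s ∘ Fin.suc)
    ≈⟨ +-cong (e-vanish (suc k) (s ∘ Fin.suc) (ℕₚ.m≤n⇒m≤1+n d≤k))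
              (*-congˡ (e-vanish k (s ∘ Fin.suc) d≤k)) ⟩
      0# + s Fin.zero * 0#
    ≈⟨ trans (+-identityˡ _) (zeroʳ _) ⟩
      0# ∎
    where open SetoidReasoning setoid

  eSeries-suc : ∀ P Q {d} (s : Fin (suc d) → Carrier) →
                let E′ = eSeries P Q (s ∘ Fin.suc) in
                eSeries P Q s ≋ ((s Fin.zero · (P ⊕ (Q ⊛ E′))) ⊕ E′)
  eSeries-suc P Q {d} s = begin
      Σ₁ (λ k → const (e k s) ⊛ W k) (suc d)
    ≈⟨ Σ₁-cong (suc d) (λ k → split (e (suc k) s′) s₀ (e k s′) (W (suc k))) ⟩
      Σ₁ (λ k → Term k ⊕ (s₀ · Term⁻ k)) (suc d)
    ≈⟨ ≋-trans (Σ₁-⊕ Term (λ k → s₀ · Term⁻ k) (suc d)) (⊕-congˡ (Σ₁-· s₀ Term⁻ (suc d))) ⟩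
      (E′ ⊕ Term (suc d)) ⊕ (s₀ · Σ₁ Term⁻ (suc d))
    ≈⟨ ⊕-cong (⊕-congˡ vanish) (·-congˡ (Σ₁-suc Term⁻ d)) ⟩
      (E′ ⊕ zeroPS) ⊕ (s₀ · (Term⁻ 1 ⊕ Σ₁ (Term⁻ ∘ suc) d))
    ≈⟨ ⊕-cong (⊕-identityʳ E′) (·-congˡ (⊕-cong (≋-trans (⊛-identityˡ _) (⊛-identityʳ P)) shiftQ)) ⟩
      E′ ⊕ (s₀ · (P ⊕ (Q ⊛ E′)))
    ≈⟨ ⊕-comm E′ (s₀ · (P ⊕ (Q ⊛ E′))) ⟩
      (s₀ · (P ⊕ (Q ⊛ E′))) ⊕ E′ ∎
    where
      open ≋-Reasoning
      s₀ = s Fin.zero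
      s′ = s ∘ Fin.suc
      E′ = eSeries P Q s′
      W Term Term⁻ : ℕ → PS
      W k  = P ⊛ (Q ^PS (k ∸ 1))
      Term k  = const (e k s′) ⊛ W k
      Term⁻ k = const (e (k ∸ 1) s′) ⊛ W k
      -- Used with e (suc k) s = e (suc k) s′ + s₀ * e k s′, which holds by definition of elem.
      split : ∀ a x b V → (const (a + x * b) ⊛ V) ≋ ((const a ⊛ V) ⊕ (x · (const b ⊛ V)))
      split a x b V n = trans (const-⊛ (a + x * b) V n)
        (trans (trans (distribʳ _ _ _) (+-congˡ (*-assoc _ _ _)))
               (sym (+-cong (const-⊛ a V n) (*-congˡ (const-⊛ b V n)))))
      vanish : Term (suc d) ≋ zeroPS
      vanish n = trans (const-⊛ _ (W (suc d)) n) (trans (*-congʳ (e-vanish d s′ ℕₚ.≤-refl)) (zeroˡ _))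
      shiftQ : Σ₁ (Term⁻ ∘ suc) d ≋ (Q ⊛ E′)
      shiftQ = ≋-trans (Σ₁-cong d (λ k → let eₖ = const (e (suc k) s′) in
                         ≋-trans (⊛-congˡ eₖ (⊛-leftComm P Q (Q ^PS k))) (⊛-leftComm eₖ Q (W (suc k)))))
                       (≋-sym (⊛-Σ₁ Q Term d))

  ⊛-eSeries : ∀ A P Q {d} (s : Fin d → Carrier) → (A ⊛ eSeries P Q s) ≋ eSeries (A ⊛ P) Q s
  ⊛-eSeries A P Q {d} s = ≋-trans (⊛-Σ₁ A (λ k → const (e k s) ⊛ (P ⊛ (Q ^PS (k ∸ 1)))) d)
    (Σ₁-cong d (λ k → let eₖ = const (e (suc k) s) in
      ≋-trans (⊛-leftComm A eₖ (P ⊛ (Q ^PS k))) (⊛-congˡ eₖ (≋-sym (⊛-assoc A P (Q ^PS k))))))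

  -- F i stands for the sum over the chains i = i₁ < ⋯ < i_k of s i₂ ⋯ s i_k · P ⊛ Q^(k-1): the
  -- hypothesis is the recursion obtained by splitting off i₁, and e_k(s) collects the chains of length k.
  eSeries-chains : ∀ P Q {d} (s : Fin d → Carrier) (F : Fin d → PS) →
                   (∀ i → F i ≋ (P ⊕ (Q ⊛ ΣFin (λ j → when (toℕ i <ᵇ toℕ j) (s j) · F j)))) →
                   ΣFin (λ i → s i · F i) ≋ eSeries P Q s
  eSeries-chains P Q {zero}  s F F-rec n = refl
  eSeries-chains P Q {suc d} s F F-rec = begin
      (s₀ · F Fin.zero) ⊕ ΣFin s′F′
    ≈⟨ ⊕-cong (·-congˡ (≋-trans (F-rec Fin.zero) (⊕-congˡ (⊛-congˡ Q (0·⊕ (F Fin.zero) (ΣFin s′F′)))))) IH ⟩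
      (s₀ · (P ⊕ (Q ⊛ ΣFin s′F′))) ⊕ eSeries P Q s′
    ≈⟨ ⊕-congʳ (·-congˡ (⊕-congˡ (⊛-congˡ Q IH))) ⟩
      (s₀ · (P ⊕ (Q ⊛ eSeries P Q s′))) ⊕ eSeries P Q s′
    ≈⟨ ≋-sym (eSeries-suc P Q s) ⟩
      eSeries P Q s ∎
    where
      open ≋-Reasoning
      s₀ = s Fin.zero
      s′ = s ∘ Fin.suc
      F′ = F ∘ Fin.suc
      s′F′ = λ i → s′ i · F′ i
      IH : ΣFin s′F′ ≋ eSeries P Q s′
      IH = eSeries-chains P Q s′ F′ (λ i → ≋-trans (F-rec (Fin.suc i)) (⊕-congˡ (⊛-congˡ Q
             (0·⊕ (F Fin.zero) (ΣFin (λ j → when (toℕ i <ᵇ toℕ j) (s′ j) · F′ j))))))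

module HookWords (h ℓ′ d : ℕ) where
  open import Data.Nat using (_+_)

  ℓ : ℕ
  ℓ = suc ℓ′

  Word : Set
  Word = List (Letter d)

  infs : ℕ → Word
  infs k = replicate k nothing

  allAbove : ℕ → Word → Bool
  allAbove a []            = true
  allAbove a (nothing ∷ w) = allAbove a w
  allAbove a (just b ∷ w)  = (a <ᵇ toℕ b) ∧ allAbove a w

  okAfter-hook : ∀ (x : Fin d) k w → okAfter (hook h) x (suc k) w ≡ allAbove (toℕ x) w
  okAfter-hook x k []            = ≡.refl
  okAfter-hook x k (nothing ∷ w) = okAfter-hook x (suc k) w
  okAfter-hook x k (just b ∷ w)  = cong₂ _∧_ (+1≤ᵇ (toℕ x) (toℕ b)) (okAfter-hook x (suc k) w)
    where
      +1≤ᵇ : ∀ m n → (m + 1 ≤ᵇ n) ≡ (m <ᵇ n)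
      +1≤ᵇ m n rewrite ℕₚ.+-comm m 1 = ≡.refl

  allAbove-take-anti : ∀ {a b r k} w → a ≤ b → r ≤ k →
                       T (allAbove b (take k w)) → T (allAbove a (take r w))
  allAbove-take-anti {r = zero}          w             _   _         _ = tt
  allAbove-take-anti {r = suc r} {suc k} []            _   _         _ = tt
  allAbove-take-anti {r = suc r} {suc k} (nothing ∷ w) a≤b (s≤s r≤k) t =
    allAbove-take-anti w a≤b r≤k t
  allAbove-take-anti {a} {b} {suc r} {suc k} (just c ∷ w) a≤b (s≤s r≤k) t
    with Equivalence.to (T-∧ {b <ᵇ toℕ c}) t
  ... | b<c , t′ = Equivalence.from T-∧
        (ℕₚ.<⇒<ᵇ (ℕₚ.≤-<-trans a≤b (ℕₚ.<ᵇ⇒< b (toℕ c) b<c)) , allAbove-take-anti w a≤b r≤k t′)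

  -- In a state (a , r), a is the value of the last integer letter read and r the number of following
  -- positions its window still covers; r = 0 means no pending constraint, and (0 , 0) is the start.
  admissible : ℕ → ℕ → Fin d → Bool
  admissible a zero    b = true
  admissible a (suc r) b = a <ᵇ toℕ b

  incCondFrom : ℕ → ℕ → Word → Bool
  incCondFrom a r []            = true
  incCondFrom a r (nothing ∷ w) = incCondFrom a (pred r) w
  incCondFrom a r (just b ∷ w)  = admissible a r b ∧ incCondFrom (toℕ b) ℓ w

  endsInfFrom : ℕ → Word → Bool
  endsInfFrom r       (nothing ∷ w) = endsInfFrom (pred r) w
  endsInfFrom r       (just b ∷ w)  = endsInfFrom ℓ w
  endsInfFrom zero    []            = true
  endsInfFrom (suc r) []            = false

  anchorFrom : ℕ → ℕ → Word → Bool
  anchorFrom a r w = incCondFrom a r w ∧ endsInfFrom r w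

  faultFreeFrom : ℕ → ℕ → Word → Bool
  faultFreeFrom a zero    []            = true
  faultFreeFrom a zero    (x ∷ w)       = false
  faultFreeFrom a (suc r) []            = false
  faultFreeFrom a (suc r) (nothing ∷ w) = faultFreeFrom a r w
  faultFreeFrom a (suc r) (just b ∷ w)  = (a <ᵇ toℕ b) ∧ faultFreeFrom (toℕ b) ℓ w

  incCond≡incCondFrom : ∀ a r w → r ≤ ℓ →
                        (incCond (hook h) ℓ w ∧ allAbove a (take r w)) ≡ incCondFrom a r w
  incCond≡incCondFrom a zero    []            _         = ≡.refl
  incCond≡incCondFrom a (suc r) []            _         = ≡.refl
  incCond≡incCondFrom a zero    (nothing ∷ w) r≤ℓ       = incCond≡incCondFrom a zero w r≤ℓ
  incCond≡incCondFrom a (suc r) (nothing ∷ w) (s≤s r≤ℓ′) =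
    incCond≡incCondFrom a r w (ℕₚ.m≤n⇒m≤1+n r≤ℓ′)
  incCond≡incCondFrom a zero    (just b ∷ w)  _         = begin
      (okAfter (hook h) b 1 (take ℓ w) ∧ incCond (hook h) ℓ w) ∧ true
    ≡⟨ ∧-identityʳ _ ⟩
      okAfter (hook h) b 1 (take ℓ w) ∧ incCond (hook h) ℓ w
    ≡⟨ cong (_∧ incCond (hook h) ℓ w) (okAfter-hook b 0 (take ℓ w)) ⟩
      allAbove (toℕ b) (take ℓ w) ∧ incCond (hook h) ℓ w
    ≡⟨ ∧-comm (allAbove (toℕ b) (take ℓ w)) _ ⟩
      incCond (hook h) ℓ w ∧ allAbove (toℕ b) (take ℓ w)
    ≡⟨ incCond≡incCondFrom (toℕ b) ℓ w ℕₚ.≤-refl ⟩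
      incCondFrom (toℕ b) ℓ w ∎
    where open ≡.≡-Reasoning
  incCond≡incCondFrom a (suc r) (just b ∷ w)  (s≤s r≤ℓ′) = begin
      (okAfter (hook h) b 1 (take ℓ w) ∧ incCond (hook h) ℓ w) ∧ ((a <ᵇ toℕ b) ∧ allAbove a (take r w))
    ≡⟨ cong (λ x → (x ∧ incCond (hook h) ℓ w) ∧ rest) (okAfter-hook b 0 (take ℓ w)) ⟩
      (allAbove (toℕ b) (take ℓ w) ∧ incCond (hook h) ℓ w) ∧ ((a <ᵇ toℕ b) ∧ allAbove a (take r w))
    ≡⟨ absorb (a <ᵇ toℕ b) _ _ _ (λ a<b → allAbove-take-anti w (ℕₚ.<⇒≤ (ℕₚ.<ᵇ⇒< a _ a<b)) r≤ℓ) ⟩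
      (a <ᵇ toℕ b) ∧ (incCond (hook h) ℓ w ∧ allAbove (toℕ b) (take ℓ w))
    ≡⟨ cong ((a <ᵇ toℕ b) ∧_) (incCond≡incCondFrom (toℕ b) ℓ w ℕₚ.≤-refl) ⟩
      (a <ᵇ toℕ b) ∧ incCondFrom (toℕ b) ℓ w ∎
    where
      open ≡.≡-Reasoning
      r≤ℓ  = ℕₚ.m≤n⇒m≤1+n r≤ℓ′
      rest = (a <ᵇ toℕ b) ∧ allAbove a (take r w)
      -- b's window covers what remains of a's, so with a < b the constraint of a follows from that of b.
      absorb : ∀ p x i y → (T p → T x → T y) → ((x ∧ i) ∧ (p ∧ y)) ≡ (p ∧ (i ∧ x))
      absorb false x     i y     _   = ∧-zeroʳ (x ∧ i)
      absorb true  false i y     _   = ≡.sym (∧-zeroʳ i)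
      absorb true  true  i true  _   = ≡.refl
      absorb true  true  i false p⇒y = ⊥-elim (p⇒y tt tt)

  ≤ᵇ-true : ∀ {m n} → m ≤ n → (m ≤ᵇ n) ≡ true
  ≤ᵇ-true m≤n = Equivalence.to T-≡ (ℕₚ.≤⇒≤ᵇ m≤n)

  ≤ᵇ-false : ∀ {m n} → n < m → (m ≤ᵇ n) ≡ false
  ≤ᵇ-false {m} {n} n<m =
    ¬-not (λ m≤ᵇn → ℕₚ.<⇒≱ n<m (ℕₚ.≤ᵇ⇒≤ m n (Equivalence.from T-≡ m≤ᵇn)))

  endsInf-short : ∀ (w : Word) → length w ≤ ℓ → endsInf ℓ w ≡ allInf w
  endsInf-short w |w|≤ℓ = cong (λ k → allInf (drop k w)) (ℕₚ.m≤n⇒m∸n≡0 |w|≤ℓ)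

  endsInf-∷ : ∀ x (w : Word) → ℓ ≤ length w → endsInf ℓ (x ∷ w) ≡ endsInf ℓ w
  endsInf-∷ x w ℓ≤|w| = cong (λ k → allInf (drop k (x ∷ w))) (ℕₚ.+-∸-assoc 1 ℓ≤|w|)

  endsInf-∞∷ : ∀ (w : Word) → endsInf ℓ (nothing ∷ w) ≡ endsInf ℓ w
  endsInf-∞∷ w with ℓ ≤? length w
  ... | yes ℓ≤|w| = endsInf-∷ nothing w ℓ≤|w|
  ... | no  ℓ≰|w| = ≡.trans (endsInf-short (nothing ∷ w) (ℕₚ.≰⇒> ℓ≰|w|))
                            (≡.sym (endsInf-short w (ℕₚ.<⇒≤ (ℕₚ.≰⇒> ℓ≰|w|))))

  endsInfFrom≡endsInf : ∀ r w →
                        endsInfFrom r w ≡ (endsInf ℓ w ∧ ((r ≤ᵇ length w) ∨ not (allInf w)))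
  endsInfFrom≡endsInf zero    []            = ≡.refl
  endsInfFrom≡endsInf (suc r) []            = ≡.refl
  endsInfFrom≡endsInf r       (nothing ∷ w) =
    ≡.trans (endsInfFrom≡endsInf (pred r) w)
            (cong₂ _∧_ (≡.sym (endsInf-∞∷ w)) (cong (_∨ not (allInf w)) (pred≤ᵇ r)))
    where
      pred≤ᵇ : ∀ r → (pred r ≤ᵇ length w) ≡ (r ≤ᵇ suc (length w))
      pred≤ᵇ zero          = ≡.refl
      pred≤ᵇ (suc zero)    = ≡.refl
      pred≤ᵇ (suc (suc r)) = ≡.refl
  endsInfFrom≡endsInf r       (just b ∷ w)  with ℓ ≤? length w
  ... | yes ℓ≤|w| = begin
      endsInfFrom ℓ w
    ≡⟨ endsInfFrom≡endsInf ℓ w ⟩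
      endsInf ℓ w ∧ ((ℓ ≤ᵇ length w) ∨ not (allInf w))
    ≡⟨ cong (λ t → endsInf ℓ w ∧ (t ∨ not (allInf w))) (≤ᵇ-true ℓ≤|w|) ⟩
      endsInf ℓ w ∧ true
    ≡⟨ ≡.sym (cong₂ _∧_ (endsInf-∷ (just b) w ℓ≤|w|) (∨-zeroʳ (r ≤ᵇ suc (length w)))) ⟩
      endsInf ℓ (just b ∷ w) ∧ ((r ≤ᵇ suc (length w)) ∨ true) ∎
    where open ≡.≡-Reasoning
  ... | no  ℓ≰|w| = begin
      endsInfFrom ℓ w
    ≡⟨ endsInfFrom≡endsInf ℓ w ⟩
      endsInf ℓ w ∧ ((ℓ ≤ᵇ length w) ∨ not (allInf w))
    ≡⟨ cong₂ (λ x t → x ∧ (t ∨ not (allInf w))) (endsInf-short w (ℕₚ.<⇒≤ |w|<ℓ))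
                                                 (≤ᵇ-false |w|<ℓ) ⟩
      allInf w ∧ not (allInf w)
    ≡⟨ ∧-not (allInf w) ⟩
      false
    ≡⟨ cong (_∧ ((r ≤ᵇ suc (length w)) ∨ true)) (≡.sym (endsInf-short (just b ∷ w) |w|<ℓ)) ⟩
      endsInf ℓ (just b ∷ w) ∧ ((r ≤ᵇ suc (length w)) ∨ true) ∎
    where
      open ≡.≡-Reasoning
      |w|<ℓ = ℕₚ.≰⇒> ℓ≰|w|
      ∧-not : ∀ x → (x ∧ not x) ≡ false
      ∧-not true  = ≡.refl
      ∧-not false = ≡.refl

  isAnchor≡anchorFrom : ∀ w → isAnchor (hook h) ℓ w ≡ anchorFrom 0 0 w
  isAnchor≡anchorFrom w = ≡.sym (cong₂ _∧_
    (≡.trans (≡.sym (incCond≡incCondFrom 0 0 w z≤n)) (∧-identityʳ _))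
    (≡.trans (endsInfFrom≡endsInf 0 w) (∧-identityʳ _)))

  anchorFrom-reset : ∀ a w → anchorFrom a 0 w ≡ anchorFrom 0 0 w
  anchorFrom-reset a w = cong (_∧ endsInfFrom 0 w) (incCondFrom-reset w)
    where
      incCondFrom-reset : ∀ w → incCondFrom a 0 w ≡ incCondFrom 0 0 w
      incCondFrom-reset []            = ≡.refl
      incCondFrom-reset (nothing ∷ w) = incCondFrom-reset w
      incCondFrom-reset (just b ∷ w)  = ≡.refl

  anchorFrom-just : ∀ a r b w →
                    anchorFrom a r (just b ∷ w) ≡ (admissible a r b ∧ anchorFrom (toℕ b) ℓ w)
  anchorFrom-just a r b w = ∧-assoc (admissible a r b) _ _

  length-infs++ : ∀ k (u : Word) → length (infs k ++ u) ≡ k + length u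
  length-infs++ k u = ≡.trans (length-++ (infs k)) (cong (_+ length u) (length-replicate k))

  noEarlyBlock-short : ∀ (u : Word) → length u ≤ ℓ → noEarlyBlock ℓ u ≡ true
  noEarlyBlock-short []      _       = ≡.refl
  noEarlyBlock-short (x ∷ u) |u|≤ℓ rewrite ≤ᵇ-true |u|≤ℓ = ≡.refl

  noEarlyBlock-long : ∀ x (w : Word) → ℓ < length (x ∷ w) →
                      noEarlyBlock ℓ (x ∷ w) ≡ (not (allInf (take ℓ (x ∷ w))) ∧ noEarlyBlock ℓ w)
  noEarlyBlock-long x w ℓ<|xw| rewrite ≤ᵇ-false ℓ<|xw| = ≡.refl

  noEarlyBlock-∷ : ∀ x (w : Word) → allInf (take ℓ (x ∷ w)) ≡ false →
                   noEarlyBlock ℓ (x ∷ w) ≡ noEarlyBlock ℓ w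
  noEarlyBlock-∷ x w has-int with ℓ <? length (x ∷ w)
  ... | yes ℓ<|xw| =
    ≡.trans (noEarlyBlock-long x w ℓ<|xw|) (cong (λ t → not t ∧ noEarlyBlock ℓ w) has-int)
  ... | no  ℓ≮|xw| =
    ≡.trans (noEarlyBlock-short (x ∷ w) (ℕₚ.≮⇒≥ ℓ≮|xw|))
            (≡.sym (noEarlyBlock-short w (ℕₚ.≤-trans (ℕₚ.n≤1+n _) (ℕₚ.≮⇒≥ ℓ≮|xw|))))

  noEarlyBlock-infs++just : ∀ k b w → k < ℓ →
                            noEarlyBlock ℓ (infs k ++ just b ∷ w) ≡ noEarlyBlock ℓ w
  noEarlyBlock-infs++just zero    b w _   = noEarlyBlock-∷ (just b) w ≡.refl
  noEarlyBlock-infs++just (suc k) b w k<ℓ =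
    ≡.trans (noEarlyBlock-∷ nothing (infs k ++ just b ∷ w) (allInf-take k<ℓ))
            (noEarlyBlock-infs++just k b w (ℕₚ.<-trans (ℕₚ.n<1+n k) k<ℓ))
    where
      allInf-take : ∀ {k m} → k < m → allInf (take m (infs k ++ just b ∷ w)) ≡ false
      allInf-take {zero}  {suc m} _         = ≡.refl
      allInf-take {suc k} {suc m} (s≤s k<m) = allInf-take k<m

  noEarlyBlock-block : ∀ x w → noEarlyBlock ℓ (infs ℓ ++ x ∷ w) ≡ false
  noEarlyBlock-block x w = begin
      noEarlyBlock ℓ (infs ℓ ++ x ∷ w)
    ≡⟨ noEarlyBlock-long nothing (infs ℓ′ ++ x ∷ w) ℓ<length ⟩
      not (allInf (take ℓ (infs ℓ ++ x ∷ w))) ∧ rest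
    ≡⟨ cong (λ t → not (allInf t) ∧ rest) (take-infs ℓ (x ∷ w)) ⟩
      not (allInf (infs ℓ)) ∧ rest
    ≡⟨ cong (λ t → not t ∧ rest) (allInf-infs ℓ) ⟩
      false ∎
    where
      open ≡.≡-Reasoning
      rest = noEarlyBlock ℓ (infs ℓ′ ++ x ∷ w)
      ℓ<length : ℓ < length (infs ℓ ++ x ∷ w)
      ℓ<length = ≡.subst (ℓ <_) (≡.sym (length-infs++ ℓ (x ∷ w))) (ℕₚ.m<m+n ℓ (s≤s z≤n))
      take-infs : ∀ k (u : Word) → take k (infs k ++ u) ≡ infs k
      take-infs zero    u = ≡.refl
      take-infs (suc k) u = cong (nothing ∷_) (take-infs k u)
      allInf-infs : ∀ k → allInf (infs k) ≡ true
      allInf-infs zero    = ≡.refl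
      allInf-infs (suc k) = allInf-infs k

  infs++∞∷ : ∀ k w → infs k ++ nothing ∷ w ≡ infs (suc k) ++ w
  infs++∞∷ zero    w = ≡.refl
  infs++∞∷ (suc k) w = cong (nothing ∷_) (infs++∞∷ k w)

  -- k counts the ∞'s read since the last integer letter, so the pending window has r = ℓ ∸ k positions.
  anchorFrom∧noEarlyBlock≡faultFreeFrom : ∀ a r k w → k + r ≡ ℓ →
    (anchorFrom a r w ∧ noEarlyBlock ℓ (infs k ++ w)) ≡ faultFreeFrom a r w
  anchorFrom∧noEarlyBlock≡faultFreeFrom a zero    k []            k≡ℓ =
    noEarlyBlock-short (infs k ++ []) (ℕₚ.≤-reflexive (≡.trans (length-infs++ k []) k≡ℓ))
  anchorFrom∧noEarlyBlock≡faultFreeFrom a zero    k (x ∷ w)       k≡ℓ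
    rewrite ≡.trans (≡.sym (ℕₚ.+-identityʳ k)) k≡ℓ | noEarlyBlock-block x w = ∧-zeroʳ _
  anchorFrom∧noEarlyBlock≡faultFreeFrom a (suc r) k []            _   = ≡.refl
  anchorFrom∧noEarlyBlock≡faultFreeFrom a (suc r) k (nothing ∷ w) k+r≡ℓ
    rewrite infs++∞∷ k w =
      anchorFrom∧noEarlyBlock≡faultFreeFrom a r (suc k) w (≡.trans (≡.sym (ℕₚ.+-suc k r)) k+r≡ℓ)
  anchorFrom∧noEarlyBlock≡faultFreeFrom a (suc r) k (just b ∷ w)  k+r≡ℓ = begin
      anchorFrom a (suc r) (just b ∷ w) ∧ noEarlyBlock ℓ (infs k ++ just b ∷ w)
    ≡⟨ cong₂ _∧_ (anchorFrom-just a (suc r) b w) (noEarlyBlock-infs++just k b w k<ℓ) ⟩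
      ((a <ᵇ toℕ b) ∧ anchorFrom (toℕ b) ℓ w) ∧ noEarlyBlock ℓ w
    ≡⟨ ∧-assoc (a <ᵇ toℕ b) _ _ ⟩
      (a <ᵇ toℕ b) ∧ (anchorFrom (toℕ b) ℓ w ∧ noEarlyBlock ℓ w)
    ≡⟨ cong ((a <ᵇ toℕ b) ∧_) (anchorFrom∧noEarlyBlock≡faultFreeFrom (toℕ b) ℓ 0 w ≡.refl) ⟩
      (a <ᵇ toℕ b) ∧ faultFreeFrom (toℕ b) ℓ w ∎
    where
      open ≡.≡-Reasoning
      k<ℓ : k < ℓ
      k<ℓ = ≡.subst (k <_) k+r≡ℓ (ℕₚ.m<m+n k (s≤s z≤n))

  isFaultFree-just : ∀ b w → isFaultFree (hook h) ℓ (just b ∷ w) ≡ faultFreeFrom (toℕ b) ℓ w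
  isFaultFree-just b w = begin
      isAnchor (hook h) ℓ (just b ∷ w) ∧ noEarlyBlock ℓ (just b ∷ w)
    ≡⟨ cong₂ _∧_ (isAnchor≡anchorFrom (just b ∷ w)) (noEarlyBlock-infs++just 0 b w (s≤s z≤n)) ⟩
      anchorFrom 0 0 (just b ∷ w) ∧ noEarlyBlock ℓ w
    ≡⟨ anchorFrom∧noEarlyBlock≡faultFreeFrom (toℕ b) ℓ 0 w ≡.refl ⟩
      faultFreeFrom (toℕ b) ℓ w ∎
    where open ≡.≡-Reasoning

module Counting {c ℓr : Level} (R : CommutativeRing c ℓr) (h ℓ′ d : ℕ)
                (s : Fin d → CommutativeRing.Carrier R) where
  open CommutativeRing R hiding (zero)
  open Series R
  open RingSums R
  open PowerSeries R
  open HookWords h ℓ′ d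

  count : (Word → Bool) → PS
  count P n = sumR (map (λ w → when (P w) (wt s w)) (allWords d n))

  count-cong : ∀ {P Q} → (∀ w → P w ≡ Q w) → count P ≋ count Q
  count-cong P≡Q n = sumR-cong (allWords d n) (λ w → reflexive (cong (λ b → when b (wt s w)) (P≡Q w)))

  count-false : count (λ _ → false) ≋ zeroPS
  count-false n = sumR-zero (allWords d n) (λ _ → refl)

  sumR-filterᵇ : ∀ P ws → sumR (map (wt s) (filterᵇ P ws)) ≈ sumR (map (λ w → when (P w) (wt s w)) ws)
  sumR-filterᵇ P []       = refl
  sumR-filterᵇ P (w ∷ ws) with P w
  ... | true  = +-congˡ (sumR-filterᵇ P ws)
  ... | false = trans (sumR-filterᵇ P ws) (sym (+-identityˡ _))

  count-zero : ∀ P → count P zero ≈ when (P []) 1#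
  count-zero P = +-identityʳ _

  countByFirstLetter : (Word → Bool) → PS
  countByFirstLetter P =
    count (λ w → P (nothing ∷ w)) ⊕ ΣFin (λ i → s i · count (λ w → P (just i ∷ w)))

  count-suc : ∀ P n → count P (suc n) ≈ countByFirstLetter P n
  count-suc P n = begin
      sumR (map φ (concatMap (λ x → map (x ∷_) W) (nothing ∷ map just (allFin d))))
    ≈⟨ sumR-concatMap φ (λ x → map (x ∷_) W) (nothing ∷ map just (allFin d)) ⟩
      sumR (map φ (map (nothing ∷_) W)) + sumR (map ψ (map just (allFin d)))
    ≡⟨ cong₂ _+_ (cong sumR (≡.sym (map-∘ W)))
                 (cong sumR (≡.trans (≡.sym (map-∘ (allFin d))) (map-tabulate (λ i → i) (ψ ∘ just)))) ⟩
      count (λ w → P (nothing ∷ w)) n + sumR (tabulate (ψ ∘ just))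
    ≈⟨ +-congˡ (sumTab-cong (λ i → trans (reflexive (cong sumR (≡.sym (map-∘ W)))) (pull-out i))) ⟩
      countByFirstLetter P n ∎
    where
      open SetoidReasoning setoid
      W = allWords d n
      φ = λ w → when (P w) (wt s w)
      ψ = λ x → sumR (map φ (map (x ∷_) W))
      pull-out : ∀ i → sumR (map (φ ∘ (just i ∷_)) W) ≈ s i * count (λ w → P (just i ∷ w)) n
      pull-out i = trans (sumR-cong W (λ w → when-*ˡ (P (just i ∷ w)) (s i) (wt s w))) (sumR-*ˡ W (s i) _)

  count-unfold : ∀ P → count P ≋ (const (when (P []) 1#) ⊕ (X ⊛ countByFirstLetter P))
  count-unfold P =
    ≋-trans (X⊛-unfold (count P)) (⊕-cong (const-cong (count-zero P)) (⊛-congˡ X (count-suc P)))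

  count-only-[] : ∀ {P} → P [] ≡ true → (∀ x w → P (x ∷ w) ≡ false) → count P ≋ onePS
  count-only-[] {P} P[] P∷ zero    = trans (count-zero P) (reflexive (cong (λ b → when b 1#) P[]))
  count-only-[] {P} P[] P∷ (suc n) = begin
      count P (suc n)
    ≈⟨ count-suc P n ⟩
      countByFirstLetter P n
    ≈⟨ +-cong (vanish nothing) (sumTab-zero (λ i → trans (*-congˡ (vanish (just i))) (zeroʳ (s i)))) ⟩
      0# + 0#
    ≈⟨ +-identityˡ 0# ⟩
      0# ∎
    where
      open SetoidReasoning setoid
      vanish : ∀ x → count (λ w → P (x ∷ w)) n ≈ 0#
      vanish x = trans (count-cong (P∷ x) n) (count-false n)

  ·-count-∧ : ∀ x b Q → (x · count (λ w → b ∧ Q w)) ≋ (when b x · count Q)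
  ·-count-∧ x true  Q n = refl
  ·-count-∧ x false Q n = trans (*-congˡ (count-false n)) (trans (zeroʳ x) (sym (zeroˡ _)))

  count-unfold-nonempty : ∀ P → P [] ≡ false → count P ≋ (X ⊛ countByFirstLetter P)
  count-unfold-nonempty P P[] = begin
      count P
    ≈⟨ count-unfold P ⟩
      const (when (P []) 1#) ⊕ (X ⊛ countByFirstLetter P)
    ≈⟨ ⊕-congʳ (const-cong (reflexive (cong (λ b → when b 1#) P[]))) ⟩
      const 0# ⊕ (X ⊛ countByFirstLetter P)
    ≈⟨ ≋-trans (⊕-congʳ const-0#) (⊕-identityˡ _) ⟩
      X ⊛ countByFirstLetter P ∎
    where open ≋-Reasoning

  count-window : ∀ {P Q} a (U : ℕ → Word → Bool) → P [] ≡ false → (∀ w → P (nothing ∷ w) ≡ Q w) →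
                 (∀ i w → P (just i ∷ w) ≡ ((a <ᵇ toℕ i) ∧ U (toℕ i) w)) →
                 count P ≋ (X ⊛ (count Q ⊕ ΣFin (λ i → when (a <ᵇ toℕ i) (s i) · count (U (toℕ i)))))
  count-window {P} a U P[] P∞ Pjust = ≋-trans (count-unfold-nonempty P P[])
    (⊛-congˡ X (⊕-cong (count-cong P∞) (ΣFin-cong (λ i →
      ≋-trans (·-congˡ (count-cong (Pjust i))) (·-count-∧ (s i) (a <ᵇ toℕ i) (U (toℕ i)))))))

  -- From state (a , suc r), a letter ∞ leads to (a , r) and an integer letter i > a to (i , ℓ).
  windowStep : (ℕ → ℕ → PS) → ℕ → ℕ → PS
  windowStep U a r = U a r ⊕ ΣFin (λ i → when (a <ᵇ toℕ i) (s i) · U (toℕ i) ℓ)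

  WindowRecursion : (ℕ → ℕ → PS) → Set ℓr
  WindowRecursion U = ∀ a r → U a (suc r) ≋ (X ⊛ windowStep U a r)

  windowRecursion-unique : ∀ {U V} → WindowRecursion U → WindowRecursion V →
                           (∀ a → U a 0 ≋ V a 0) → ∀ a r → U a r ≋ V a r
  windowRecursion-unique {U} {V} U-rec V-rec U≋V a r n = go n a r
    where
      go : ∀ n a r → U a r n ≈ V a r n
      go n       a zero    = U≋V a n
      go zero    a (suc r) = trans (trans (U-rec a r zero) (X⊛-zero (windowStep U a r)))
                                   (sym (trans (V-rec a r zero) (X⊛-zero (windowStep V a r))))
      go (suc n) a (suc r) = begin
          U a (suc r) (suc n)
        ≈⟨ trans (U-rec a r (suc n)) (X⊛-suc (windowStep U a r) n) ⟩
          U a r n + ΣFin (λ i → when (a <ᵇ toℕ i) (s i) · U (toℕ i) ℓ) n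
        ≈⟨ +-cong (go n a r) (sumTab-cong (λ i → *-congˡ {when (a <ᵇ toℕ i) (s i)} (go n (toℕ i) ℓ))) ⟩
          V a r n + ΣFin (λ i → when (a <ᵇ toℕ i) (s i) · V (toℕ i) ℓ) n
        ≈⟨ sym (trans (V-rec a r (suc n)) (X⊛-suc (windowStep V a r) n)) ⟩
          V a (suc r) (suc n) ∎
        where open SetoidReasoning setoid

  windowRecursion-⊛ : ∀ {U} → WindowRecursion U → ∀ g → WindowRecursion (λ a r → U a r ⊛ g)
  windowRecursion-⊛ {U} U-rec g a r = begin
      U a (suc r) ⊛ g
    ≈⟨ ⊛-congʳ g (U-rec a r) ⟩
      (X ⊛ (U a r ⊕ ΣFin F)) ⊛ g
    ≈⟨ ⊛-assoc X (U a r ⊕ ΣFin F) g ⟩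
      X ⊛ ((U a r ⊕ ΣFin F) ⊛ g)
    ≈⟨ ⊛-congˡ X (≋-trans (⊛-distribʳ (U a r) (ΣFin F) g) (⊕-congˡ (ΣFin-⊛ F g))) ⟩
      X ⊛ ((U a r ⊛ g) ⊕ ΣFin (λ i → F i ⊛ g))
    ≈⟨ ⊛-congˡ X (⊕-congˡ {U a r ⊛ g} (ΣFin-cong (λ i → ·-⊛ (wₐ i) (U (toℕ i) ℓ) g))) ⟩
      X ⊛ ((U a r ⊛ g) ⊕ ΣFin (λ i → wₐ i · (U (toℕ i) ℓ ⊛ g))) ∎
    where
      open ≋-Reasoning
      wₐ = λ i → when (a <ᵇ toℕ i) (s i)
      F  = λ i → wₐ i · U (toℕ i) ℓ

  anchors faultFree : ℕ → ℕ → PS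
  anchors a r   = count (anchorFrom a r)
  faultFree a r = count (faultFreeFrom a r)

  anchors-window : WindowRecursion anchors
  anchors-window a r = count-window {anchorFrom a (suc r)} {anchorFrom a r} a (λ b → anchorFrom b ℓ)
                                    ≡.refl (λ _ → ≡.refl) (anchorFrom-just a (suc r))

  faultFree-window : WindowRecursion faultFree
  faultFree-window a r = count-window {faultFreeFrom a (suc r)} {faultFreeFrom a r} a (λ b → faultFreeFrom b ℓ)
                                      ≡.refl (λ _ → ≡.refl) (λ _ _ → ≡.refl)

  faultFree-zero : ∀ a → faultFree a 0 ≋ onePS
  faultFree-zero a = count-only-[] {faultFreeFrom a 0} ≡.refl (λ _ _ → ≡.refl)

  anchors≋faultFree⊛anchors : ∀ a r → anchors a r ≋ (faultFree a r ⊛ anchors 0 0)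
  anchors≋faultFree⊛anchors =
    windowRecursion-unique anchors-window (windowRecursion-⊛ faultFree-window (anchors 0 0)) base
    where
      open ≋-Reasoning
      base : ∀ a → anchors a 0 ≋ (faultFree a 0 ⊛ anchors 0 0)
      base a = begin
        anchors a 0                   ≈⟨ count-cong (anchorFrom-reset a) ⟩
        anchors 0 0                   ≈⟨ ≋-sym (⊛-identityˡ (anchors 0 0)) ⟩
        onePS ⊛ anchors 0 0           ≈⟨ ⊛-congʳ (anchors 0 0) (≋-sym (faultFree-zero a)) ⟩
        faultFree a 0 ⊛ anchors 0 0   ∎

  faultFreeWords : PS
  faultFreeWords = count (isFaultFree (hook h) ℓ)

  faultFreeTails : PS
  faultFreeTails = ΣFin (λ i → s i · faultFree (toℕ i) ℓ)

  faultFreeWords-unfold : faultFreeWords ≋ (X ⊛ (onePS ⊕ faultFreeTails))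
  faultFreeWords-unfold = ≋-trans (count-unfold-nonempty (isFaultFree (hook h) ℓ) ≡.refl)
    (⊛-congˡ X (⊕-cong (count-only-[] {λ w → isFaultFree (hook h) ℓ (nothing ∷ w)} ≡.refl λ _ _ → ≡.refl)
                       (ΣFin-cong (λ i → ·-congˡ (count-cong (isFaultFree-just i))))))

  anchors-renewal : anchors 0 0 ≋ (onePS ⊕ (faultFreeWords ⊛ anchors 0 0))
  anchors-renewal = begin
      C
    ≈⟨ count-unfold (anchorFrom 0 0) ⟩
      onePS ⊕ (X ⊛ (C ⊕ ΣFin (λ i → s i · anchors (toℕ i) ℓ)))
    ≈⟨ ⊕-congˡ (⊛-congˡ X (⊕-cong (≋-sym (⊛-identityˡ C)) (ΣFin-cong (λ i →
         ≋-trans (·-congˡ (anchors≋faultFree⊛anchors (toℕ i) ℓ))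
                 (≋-sym (·-⊛ (s i) (faultFree (toℕ i) ℓ) C)))))) ⟩
      onePS ⊕ (X ⊛ ((onePS ⊛ C) ⊕ ΣFin (λ i → (s i · faultFree (toℕ i) ℓ) ⊛ C)))
    ≈⟨ ⊕-congˡ (⊛-congˡ X (⊕-congˡ {onePS ⊛ C} (≋-sym (ΣFin-⊛ (λ i → s i · faultFree (toℕ i) ℓ) C)))) ⟩
      onePS ⊕ (X ⊛ ((onePS ⊛ C) ⊕ (faultFreeTails ⊛ C)))
    ≈⟨ ⊕-congˡ (⊛-congˡ X (≋-sym (⊛-distribʳ onePS faultFreeTails C))) ⟩
      onePS ⊕ (X ⊛ ((onePS ⊕ faultFreeTails) ⊛ C))
    ≈⟨ ⊕-congˡ (≋-sym (⊛-assoc X (onePS ⊕ faultFreeTails) C)) ⟩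
      onePS ⊕ ((X ⊛ (onePS ⊕ faultFreeTails)) ⊛ C)
    ≈⟨ ⊕-congˡ (⊛-congʳ C (≋-sym faultFreeWords-unfold)) ⟩
      onePS ⊕ (faultFreeWords ⊛ C) ∎
    where
      open ≋-Reasoning
      C = anchors 0 0

  S≋anchors : S (hook h) ℓ d s ≋ anchors 0 0
  S≋anchors n =
    trans (sumR-filterᵇ (isAnchor (hook h) ℓ) (allWords d n)) (count-cong isAnchor≡anchorFrom n)

  B≋faultFreeWords : B (hook h) ℓ d s ≋ faultFreeWords
  B≋faultFreeWords n = sumR-filterᵇ (isFaultFree (hook h) ℓ) (allWords d n)

  S⊛[1-B]≋1 : (S (hook h) ℓ d s ⊛ (onePS ⊖ B (hook h) ℓ d s)) ≋ onePS
  S⊛[1-B]≋1 = ≋-trans (⊛-cong S≋anchors (⊖-congˡ onePS B≋faultFreeWords))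
                      (⊛-inverse anchors-renewal)

  faultFreeAfter : ℕ → PS
  faultFreeAfter a = ΣFin (λ i → when (a <ᵇ toℕ i) (s i) · faultFree (toℕ i) ℓ)

  faultFree-form : ∀ a r → faultFree a r ≋ ((X ^PS r) ⊕ (Σ₁ (X ^PS_) r ⊛ faultFreeAfter a))
  faultFree-form a zero    = ≋-trans (faultFree-zero a)
    (≋-sym (≋-trans (⊕-congˡ {onePS} (⊛-zeroˡ (faultFreeAfter a))) (⊕-identityʳ onePS)))
  faultFree-form a (suc r) = begin
      faultFree a (suc r)
    ≈⟨ faultFree-window a r ⟩
      X ⊛ (faultFree a r ⊕ G)
    ≈⟨ ⊛-congˡ X (⊕-congʳ {g = G} (faultFree-form a r)) ⟩
      X ⊛ (((X ^PS r) ⊕ (Yᵣ ⊛ G)) ⊕ G)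
    ≈⟨ ⊛-congˡ X (≋-trans (⊕-assoc (X ^PS r) (Yᵣ ⊛ G) G) (⊕-congˡ {X ^PS r} collect)) ⟩
      X ⊛ ((X ^PS r) ⊕ ((onePS ⊕ Yᵣ) ⊛ G))
    ≈⟨ ⊛-distribˡ X (X ^PS r) ((onePS ⊕ Yᵣ) ⊛ G) ⟩
      (X ^PS suc r) ⊕ (X ⊛ ((onePS ⊕ Yᵣ) ⊛ G))
    ≈⟨ ⊕-congˡ {X ^PS suc r} (≋-sym (⊛-assoc X (onePS ⊕ Yᵣ) G)) ⟩
      (X ^PS suc r) ⊕ ((X ⊛ (onePS ⊕ Yᵣ)) ⊛ G)
    ≈⟨ ⊕-congˡ {X ^PS suc r} (⊛-congʳ G (≋-sym (Σ₁-powers-suc X r))) ⟩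
      (X ^PS suc r) ⊕ (Σ₁ (X ^PS_) (suc r) ⊛ G) ∎
    where
      open ≋-Reasoning
      G  = faultFreeAfter a
      Yᵣ = Σ₁ (X ^PS_) r
      collect : ((Yᵣ ⊛ G) ⊕ G) ≋ ((onePS ⊕ Yᵣ) ⊛ G)
      collect = ≋-trans (⊕-comm (Yᵣ ⊛ G) G)
                        (≋-trans (⊕-congʳ (≋-sym (⊛-identityˡ G))) (≋-sym (⊛-distribʳ onePS Yᵣ G)))

  faultFreeWords-series : faultFreeWords ≋ (X ⊕ eSeries (X ^PS suc ℓ) (Σ₁ (X ^PS_) ℓ) s)
  faultFreeWords-series = begin
      faultFreeWords
    ≈⟨ faultFreeWords-unfold ⟩
      X ⊛ (onePS ⊕ faultFreeTails)
    ≈⟨ ≋-trans (⊛-distribˡ X onePS faultFreeTails) (⊕-congʳ (⊛-identityʳ X)) ⟩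
      X ⊕ (X ⊛ faultFreeTails)
    ≈⟨ ⊕-congˡ (⊛-congˡ X (eSeries-chains (X ^PS ℓ) Y s (λ i → faultFree (toℕ i) ℓ)
                                                       (λ i → faultFree-form (toℕ i) ℓ))) ⟩
      X ⊕ (X ⊛ eSeries (X ^PS ℓ) Y s)
    ≈⟨ ⊕-congˡ (⊛-eSeries X (X ^PS ℓ) Y s) ⟩
      X ⊕ eSeries (X ^PS suc ℓ) Y s ∎
    where
      open ≋-Reasoning
      Y = Σ₁ (X ^PS_) ℓ

  B-series : B (hook h) ℓ d s ≋ (X ⊕ eSeries (X ^PS suc ℓ) (Σ₁ (X ^PS_) ℓ) s)
  B-series = ≋-trans B≋faultFreeWords faultFreeWords-series

open import Data.Nat using (_+_)

-- The part μ₀ = h never enters the anchor condition.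
theorem5p3 : ∀ {c ℓr : Level} (R : CommutativeRing c ℓr) (ℓ h d : ℕ)
             → 1 ≤ ℓ → 1 ≤ h → 1 ≤ d → d ≤ h
             → (s : Fin d → CommutativeRing.Carrier R)
             → let open Series R in
               (B (hook h) ℓ d s
                  ≋ (X ⊕ Σ₁ (λ k → const (e k s) ⊛ ((X ^PS (ℓ + 1)) ⊛ (Σ₁ (λ j → X ^PS j) ℓ ^PS (k ∸ 1)))) d))
               × ((S (hook h) ℓ d s ⊛ (onePS ⊖ B (hook h) ℓ d s)) ≋ onePS)
theorem5p3 R (suc ℓ′) h d (s≤s z≤n) _ _ _ s rewrite ℕₚ.+-comm ℓ′ 1 =
  B-series , S⊛[1-B]≋1
  where open Counting R h ℓ′ d s
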